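{- For every partition $\lambda$, $$s_\lambda=\sum_{\alpha:\ \operatorname{shape}(\alpha)=\lambda'}\mathcal{R}_\alpha,$$ where the sum is over all compositions $\alpha$ whose parts rearrange to $\lambda'$, the conjugate partition of $\lambda$, and $s_\lambda$ is the Schur function.
   Context: Diagrams use the French convention: a composition $\alpha=(\alpha_1,\dots,\alpha_\ell)$ (finite sequence of positive integers, $\ell(\alpha)=\ell$) has diagram with $\alpha_i$ left-justified cells in the $i$-th row from the bottom; cell $(i,j)$ is in row $i$ from the bottom, column $j$ from the left. $\operatorname{shape}(\alpha)$ is the partition obtained by sorting the parts of $\alpha$ in weakly decreasing order. A semi-standard Young row-strict composition tableau (SSYRT) of shape $\alpha$ is a filling $T$ of the diagram of $\alpha$ with positive integers such that, setting $T(i,j)=\infty$ for cells not in the diagram: (1) entries strictly increase left to right along rows; (2) entries of the leftmost column weakly decrease from top to bottom; (3) for all $1\le i<j\le\ell(\alpha)$ and $1\le k<m$ ($m$ the largest part of $\alpha$), if $T(j,k)<T(i,k+1)$ then $T(j,k+1)\le T(i,k+1)$. The weight is $x^T=\prod_t x_t^{v_t}$ with $v_t$ the number of entries equal to $t$. The Young row-strict quasisymmetric Schur function is $\mathcal{R}_\alpha=\sum_T x^T$, summed over all SSYRT $T$ of shape $\alpha$. -}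

module Defs where

open import Data.Nat using (ℕ; zero; suc; _+_; _≤_; _<_; _≥_; _⊔_; _≤?_; _≟_; _≤ᵇ_; _<ᵇ_)
open import Data.Nat.Properties using (≤-decTotalOrder)
open import Data.Bool using (Bool; true; false; _∨_; not; T)
open import Data.Maybe using (Maybe; just; nothing)
open import Data.List using (List; []; _∷_; map; length; filter; upTo; concatMap; reverse; foldr)
open import Data.Nat.ListAction using (sum)
open import Data.List.Relation.Unary.All using (All)
open import Data.List.Relation.Unary.Linked using (Linked)
open import Data.Product using (Σ; _×_; _,_)
open import Data.Unit using (⊤)
open import Data.Empty using (⊥)
open import Relation.Binary.PropositionalEquality using (_≡_)
import Data.List.Sort.InsertionSort ≤-decTotalOrder as Ins

IsPartition : List ℕ → Set
IsPartition λ′ = All (1 ≤_) λ′ × Linked _≥_ λ′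

IsComposition : List ℕ → Set
IsComposition α = All (1 ≤_) α

maxPart : List ℕ → ℕ
maxPart = foldr _⊔_ 0

conj : List ℕ → List ℕ
conj λ′ = map (λ i → length (filter (λ p → suc i ≤? p) λ′)) (upTo (maxPart λ′))

shape : List ℕ → List ℕ
shape α = reverse (Ins.sort α)

-- Fillings: a filling is a list of rows (bottom row first), each a list
-- of entries (left to right).

HasShape : List ℕ → List (List ℕ) → Set
HasShape α Tab = map length Tab ≡ α

PositiveEntries : List (List ℕ) → Set
PositiveEntries Tab = All (All (1 ≤_)) Tab

-- the monomial x^v, v = (v_1,…,v_n), is the weight of the filling:
-- all entries lie in {1,…,n} and t occurs exactly v_t times.
HasWeight : List ℕ → List (List ℕ) → Set
HasWeight v Tab =
  All (All (_≤ length v)) Tab ×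
  map (λ i → sum (map (λ r → length (filter (λ x → suc i ≟ x) r)) Tab)) (upTo (length v)) ≡ v

-- Semistandard Young tableaux (French): rows weakly increase, columns
-- strictly increase from bottom to top.

-- r′ sits on top of r: every cell of r′ has a cell below it in r, with a
-- strictly smaller entry
ColStrict : List ℕ → List ℕ → Set
ColStrict _ [] = ⊤
ColStrict [] (_ ∷ _) = ⊥
ColStrict (a ∷ r) (b ∷ r′) = (a < b) × ColStrict r r′

IsSSYT : List ℕ → List ℕ → List (List ℕ) → Set
IsSSYT λ′ v Tab =
  HasShape λ′ Tab × PositiveEntries Tab × HasWeight v Tab ×
  All (Linked _≤_) Tab × Linked ColStrict Tab

SSYT : List ℕ → List ℕ → Set
SSYT λ′ v = Σ (List (List ℕ)) (IsSSYT λ′ v)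

-- ℕ ∪ {∞}, with ∞ represented by nothing
nth : {A : Set} → List A → ℕ → Maybe A
nth [] _ = nothing
nth (x ∷ _) zero = just x
nth (_ ∷ xs) (suc n) = nth xs n

-- T(i,j), 0-indexed: row i from the bottom, column j from the left; ∞ outside
entry : List (List ℕ) → ℕ → ℕ → Maybe ℕ
entry Tab i j with nth Tab i
... | nothing = nothing
... | just r = nth r j

_<∞_ : Maybe ℕ → Maybe ℕ → Bool
just a <∞ just b = a <ᵇ b
just a <∞ nothing = true
nothing <∞ _ = false

_≤∞_ : Maybe ℕ → Maybe ℕ → Bool
just a ≤∞ just b = a ≤ᵇ b
just a ≤∞ nothing = true
nothing ≤∞ just _ = false
nothing ≤∞ nothing = true

-- condition (3) for (0-indexed) rows i < j and columns k, k+1: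
-- T(j,k) < T(i,k+1)  implies  T(j,k+1) ≤ T(i,k+1)
triple : List (List ℕ) → ℕ → ℕ → ℕ → Bool
triple Tab i j k =
  not (entry Tab j k <∞ entry Tab i (suc k)) ∨ (entry Tab j (suc k) ≤∞ entry Tab i (suc k))

-- all (i, j, k) with 0 ≤ i < j < ℓ and 0 ≤ k < m - 1
-- (i.e. 1 ≤ i < j ≤ ℓ and 1 ≤ k < m in 1-indexed terms)
record Triple : Set where
  constructor tri
  field
    ti tj tk : ℕ

triples : ℕ → ℕ → List Triple
triples ℓ m =
  concatMap (λ i → concatMap (λ d → map (λ k → tri i (suc (i + d)) k)
                                        (upTo (m Data.Nat.∸ 1)))
                             (upTo (ℓ Data.Nat.∸ suc i)))
            (upTo ℓ)

-- leftmost column weakly decreasing from top to bottom, i.e. weakly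
-- increasing from bottom to top
FirstLe : List ℕ → List ℕ → Set
FirstLe (a ∷ _) (b ∷ _) = a ≤ b
FirstLe _ _ = ⊤

IsSSYRT : List ℕ → List ℕ → List (List ℕ) → Set
IsSSYRT α v Tab =
  HasShape α Tab × PositiveEntries Tab × HasWeight v Tab ×
  All (Linked _<_) Tab ×
  Linked FirstLe Tab ×
  All (λ p → T (triple Tab (Triple.ti p) (Triple.tj p) (Triple.tk p)))
      (triples (length α) (maxPart α))

SSYRT : List ℕ → List ℕ → Set
SSYRT α v = Σ (List (List ℕ)) (IsSSYRT α v)

{-# OPTIONS --safe #-}
-- A composition tableau is read column by column: the k-th row of the SSYT is
-- the k-th column of the SSYRT, sorted. Conversely, by condition (2) the first
-- column of the SSYRT is the bottom row of the SSYT, and conditions (1) and (3)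
-- force every further column: going down from the top row, each row takes the
-- least entry of the next SSYT row that exceeds its own entry and is still
-- unused. For sorted rows, column strictness of the SSYT amounts to the counting
-- condition #{z ∈ Sₖ₊₁ | z ≤ y} ≤ #{z ∈ Sₖ | z < y} for all y, and this
-- Hall-type condition is exactly what lets the greedy choice use up every entry.
-- Entries are only moved around, so weights agree; the row lengths of the SSYT
-- are the column lengths of α, i.e. conj α, whose conjugate is shape α.

module Submission where

open import Defs
open import Data.Nat using (ℕ; zero; suc; _+_; _∸_; _≤_; _<_; _≥_; _≤?_; _<?_; _≟_; _<ᵇ_; z≤n; s≤s)
open import Data.Nat.Properties
open import Data.Nat.ListAction using (sum)
open import Data.Bool using (true; false; _∨_; not; T)
open import Data.Bool.Properties using (T-irrelevant)
open import Data.Maybe using (Maybe; just; nothing; maybe′)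
import Data.Maybe as Maybe
open import Data.Maybe.Properties using (just-injective)
open import Data.List using (List; []; _∷_; _++_; map; length; filter; zip; zipWith; replicate; foldr; catMaybes; fromMaybe; reverse; upTo; applyUpTo; concat)
open import Data.List.Properties using (filter-accept; filter-reject; filter-none; filter-++; length-++; ++-identityʳ; length-map; length-replicate; length-applyUpTo; mapMaybe-just; ∷-injectiveˡ; ∷-injectiveʳ; ++-assoc; map-cong;
         map-upTo; map-applyUpTo; unfold-reverse; length-filter;
         map-injective; ≡-dec)
open import Data.List.Relation.Unary.All using (All; []; _∷_)
import Data.List.Relation.Unary.All as All
import Data.List.Relation.Unary.All.Properties as All
open import Data.List.Relation.Unary.AllPairs using (AllPairs; []; _∷_)
import Data.List.Relation.Unary.AllPairs.Properties as AllPairs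
open import Data.List.Relation.Unary.Linked using (Linked; []; [-]; _∷_)
import Data.List.Relation.Unary.Linked as Linked
open import Data.List.Relation.Unary.Linked.Properties using (Linked⇒All; Linked⇒AllPairs; AllPairs⇒Linked)
import Data.List.Relation.Unary.Linked.Properties as Linked
open import Data.List.Relation.Binary.Permutation.Propositional using (_↭_; ↭-refl; ↭-sym; ↭-trans; ↭-reflexive; prep; ↭⇒↭ₛ; module PermutationReasoning)
open import Data.List.Relation.Binary.Permutation.Setoid.Properties using (foldr-commMonoid)
open import Data.List.Relation.Binary.Permutation.Propositional.Properties using (filter-↭; ↭-length; All-resp-↭; shift; shifts; ++⁺; ++⁺ˡ; ↭-reverse)
open import Data.List.Relation.Binary.Pointwise using (Pointwise; []; _∷_; Pointwise-≡⇒≡; Pointwise-length)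
open import Data.List.Sort.InsertionSort.Base ≤-decTotalOrder using (insert; sort)
open import Data.List.Sort.InsertionSort.Properties ≤-decTotalOrder using (insert-↭; insert-↗; insert-swap; sort-↭; sort-↗)
open import Data.Product using (Σ; _×_; _,_; proj₁; proj₂; ∃; map₂)
open import Data.Unit using (⊤; tt)
open import Data.Empty using (⊥; ⊥-elim)
open import Level using (0ℓ)
open import Relation.Nullary using (¬_; yes; no)
open import Relation.Nullary.Irrelevant using (Irrelevant)
import Axiom.UniquenessOfIdentityProofs as UIP
open import Relation.Nullary.Decidable using (dec-true; dec-false)
open import Relation.Unary using (Pred; Decidable)
open import Relation.Binary.PropositionalEquality
open import Function using (id; _∘_)
open import Function.Bundles using (_↔_; mk↔ₛ′; _⇔_; mk⇔; Equivalence)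

Sorted : List ℕ → Set
Sorted = Linked _≤_

insert-≤ : ∀ {x y} ys → x ≤ y → insert x (y ∷ ys) ≡ x ∷ y ∷ ys
insert-≤ {x} {y} ys x≤y rewrite dec-true (x ≤? y) x≤y = refl

insert-> : ∀ {x y} ys → y < x → insert x (y ∷ ys) ≡ y ∷ insert x ys
insert-> {x} {y} ys y<x rewrite dec-false (x ≤? y) (<⇒≱ y<x) = refl

insertAll : List ℕ → List ℕ → List ℕ
insertAll xs ys = foldr insert ys xs

insertAll-↗ : ∀ xs {ys} → Sorted ys → Sorted (insertAll xs ys)
insertAll-↗ [] s = s
insertAll-↗ (x ∷ xs) s = insert-↗ x (insertAll-↗ xs s)

insertAll-↭ : ∀ xs ys → insertAll xs ys ↭ xs ++ ys
insertAll-↭ [] ys = ↭-refl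
insertAll-↭ (x ∷ xs) ys = ↭-trans (insert-↭ x (insertAll xs ys)) (prep x (insertAll-↭ xs ys))

insertAll-[]-↭ : ∀ xs → insertAll xs [] ↭ xs
insertAll-[]-↭ xs = subst (insertAll xs [] ↭_) (++-identityʳ xs) (insertAll-↭ xs [])

insertAll-insert : ∀ y xs ys → insert y (insertAll xs ys) ≡ insertAll xs (insert y ys)
insertAll-insert y [] ys = refl
insertAll-insert y (x ∷ xs) ys =
  trans (Pointwise-≡⇒≡ (insert-swap y x (insertAll xs ys))) (cong (insert x) (insertAll-insert y xs ys))

All-insert⁻ : ∀ {P : ℕ → Set} x ys → All P (insert x ys) → P x × All P ys
All-insert⁻ x ys h with All-resp-↭ (insert-↭ x ys) h
... | px ∷ pys = px , pys

All-insert⁺ : ∀ {P : ℕ → Set} x ys → P x → All P ys → All P (insert x ys)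
All-insert⁺ x ys px pys = All-resp-↭ (↭-sym (insert-↭ x ys)) (px ∷ pys)

sorted⇒All : ∀ {x xs} → Sorted (x ∷ xs) → All (x ≤_) xs
sorted⇒All [-] = []
sorted⇒All (x≤y ∷ s) = Linked⇒All ≤-trans x≤y s

All⇒sorted : ∀ {x xs} → All (x ≤_) xs → Sorted xs → Sorted (x ∷ xs)
All⇒sorted [] _ = [-]
All⇒sorted (x≤y ∷ _) s = x≤y ∷ s

insert-head : ∀ x xs → All (x ≤_) xs → insert x xs ≡ x ∷ xs
insert-head x [] _ = refl
insert-head x (y ∷ xs) (x≤y ∷ _) = insert-≤ xs x≤y

insertAll-sorted : ∀ xs → Sorted xs → insertAll xs [] ≡ xs
insertAll-sorted [] s = refl
insertAll-sorted (x ∷ xs) s rewrite insertAll-sorted xs (Linked.tail s) = insert-head x xs (sorted⇒All s)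

count : {P : Pred ℕ 0ℓ} → Decidable P → List ℕ → ℕ
count P? xs = length (filter P? xs)

module _ {P : Pred ℕ 0ℓ} (P? : Decidable P) where

  count-accept : ∀ {x} xs → P x → count P? (x ∷ xs) ≡ suc (count P? xs)
  count-accept xs px = cong length (filter-accept P? px)

  count-reject : ∀ {x} xs → ¬ P x → count P? (x ∷ xs) ≡ count P? xs
  count-reject xs ¬px = cong length (filter-reject P? ¬px)

  count-none : ∀ {xs} → All (λ x → ¬ P x) xs → count P? xs ≡ 0
  count-none h = cong length (filter-none P? h)

  count-++ : ∀ xs ys → count P? (xs ++ ys) ≡ count P? xs + count P? ys
  count-++ xs ys = trans (cong length (filter-++ P? xs ys)) (length-++ (filter P? xs))

  count-↭ : ∀ {xs ys} → xs ↭ ys → count P? xs ≡ count P? ys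
  count-↭ p = ↭-length (filter-↭ P? p)

  count-insert : ∀ x ys → count P? (insert x ys) ≡ count P? (x ∷ ys)
  count-insert x ys = count-↭ (insert-↭ x ys)

  count-≤-∷ : ∀ x xs → count P? xs ≤ count P? (x ∷ xs)
  count-≤-∷ x xs with P? x
  ... | yes px = m≤n⇒m≤1+n ≤-refl
  ... | no _ = ≤-refl

count-mono : ∀ {P Q : Pred ℕ 0ℓ} (P? : Decidable P) (Q? : Decidable Q) {xs} →
  All (λ x → P x → Q x) xs → count P? xs ≤ count Q? xs
count-mono P? Q? [] = z≤n
count-mono P? Q? {x ∷ _} (f ∷ fs) with P? x | Q? x
... | yes _ | yes _ = s≤s (count-mono P? Q? fs)
... | yes p | no ¬q = ⊥-elim (¬q (f p))
... | no _ | yes _ = m≤n⇒m≤1+n (count-mono P? Q? fs)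
... | no _ | no _ = count-mono P? Q? fs

count-cong : ∀ {P Q : Pred ℕ 0ℓ} (P? : Decidable P) (Q? : Decidable Q) {xs} →
  All (λ x → (P x → Q x) × (Q x → P x)) xs → count P? xs ≡ count Q? xs
count-cong P? Q? h = ≤-antisym (count-mono P? Q? (All.map proj₁ h)) (count-mono Q? P? (All.map proj₂ h))

T-not∨⁻ : ∀ b {c} → T (not b ∨ c) → T b → T c
T-not∨⁻ true h _ = h

T-not∨⁺ : ∀ b {c} → (T b → T c) → T (not b ∨ c)
T-not∨⁺ true f = f tt
T-not∨⁺ false f = tt

Cell : Set
Cell = Maybe ℕ

RowStep : Cell × Cell → Set
RowStep (_ , nothing) = ⊤
RowStep (nothing , just _) = ⊥
RowStep (just a , just b) = a < b

-- Condition (3) for a lower row with cells (T(i,k), T(i,k+1)) = (_ , b) and an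
-- upper row with cells (T(j,k), T(j,k+1)) = (a′ , b′).
TripleRule : Cell × Cell → Cell × Cell → Set
TripleRule (_ , b) (a′ , b′) = T (not (a′ <∞ b) ∨ (b′ ≤∞ b))

-- A row with cells (a , b) in columns k, k + 1 had no claim on an unused entry z
-- of the next SSYT row: if a < z then b ≤ z.
Skips : ℕ → Cell × Cell → Set
Skips z = TripleRule (nothing , just z)

TripleRule-∞ : ∀ c q → TripleRule (c , nothing) q
TripleRule-∞ c (nothing , _) = tt
TripleRule-∞ c (just _ , nothing) = tt
TripleRule-∞ c (just _ , just _) = tt

Skips-unreached : ∀ {z a} b → ¬ a < z → Skips z (just a , b)
Skips-unreached {z} {a} b a≮z = T-not∨⁺ (a <ᵇ z) (λ t → ⊥-elim (a≮z (<ᵇ⇒< a z t)))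

Skips-below : ∀ {z} a {b} → b ≤ z → Skips z (a , just b)
Skips-below nothing b≤z = tt
Skips-below {z} (just a) {b} b≤z = T-not∨⁺ (a <ᵇ z) (λ _ → ≤⇒≤ᵇ b≤z)

Skips⇒≤ : ∀ {z a b} → Skips z (just a , just b) → a < z → b ≤ z
Skips⇒≤ {z} {a} {b} h a<z = ≤ᵇ⇒≤ b z (T-not∨⁻ (a <ᵇ z) h (<⇒<ᵇ a<z))

Skips-∞⇒≮ : ∀ {z a} → Skips z (just a , nothing) → ¬ a < z
Skips-∞⇒≮ {z} {a} h a<z = T-not∨⁻ (a <ᵇ z) h (<⇒<ᵇ a<z)

consCell : Cell → List ℕ → List ℕ
consCell = maybe′ _∷_ id

insertCell : Cell → List ℕ → List ℕ
insertCell nothing ys = ys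
insertCell (just y) ys = insert y ys

pickAbove : Cell → List ℕ → Cell × List ℕ
pickAbove nothing S = nothing , S
pickAbove (just a) [] = nothing , []
pickAbove (just a) (x ∷ S) with a <? x
... | yes _ = just x , S
... | no _ = map₂ (x ∷_) (pickAbove (just a) S)

greedyColumn : List Cell → List ℕ → List Cell × List ℕ
greedyColumn [] S = [] , S
greedyColumn (a ∷ as) S =
  let (bs , S₁) = greedyColumn as S
      (b , S₂) = pickAbove a S₁
  in b ∷ bs , S₂

-- The greedy filling of a column

record PickSpec (a : Cell) (S : List ℕ) (b : Cell) (S′ : List ℕ) : Set where
  constructor pickSpec
  field
    restores : insertCell b S′ ≡ S
    step     : RowStep (a , b)
    skipped  : All (λ z → Skips z (a , b)) S′
    sorted   : Sorted S′

pickAbove-spec : ∀ a S → Sorted S → PickSpec a S (proj₁ (pickAbove a S)) (proj₂ (pickAbove a S))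
pickAbove-spec nothing S s = pickSpec refl tt (All.tabulate (λ _ → tt)) s
pickAbove-spec (just a) [] s = pickSpec refl tt [] []
pickAbove-spec (just a) (x ∷ S) s with a <? x
... | yes a<x = pickSpec (insert-head x S (sorted⇒All s)) a<x
                  (All.map (Skips-below (just a)) (sorted⇒All s)) (Linked.tail s)
... | no a≮x with pickAbove (just a) S | pickAbove-spec (just a) S (Linked.tail s)
...   | nothing , S′ | pickSpec refl _ h s′ = pickSpec refl tt (Skips-unreached nothing a≮x ∷ h) s
...   | just y , S′ | pickSpec e a<y h s′ =
        pickSpec (trans (insert-> S′ x<y) (cong (x ∷_) e)) a<y (Skips-unreached (just y) a≮x ∷ h)
          (All⇒sorted x≤S′ s′)
  where
  x<y : x < y
  x<y = ≤-<-trans (≮⇒≥ a≮x) a<y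
  x≤S′ : All (x ≤_) S′
  x≤S′ = proj₂ (All-insert⁻ y S′ (subst (All (x ≤_)) (sym e) (sorted⇒All s)))

record GreedySpec (as : List Cell) (S : List ℕ) (bs : List Cell) (S′ : List ℕ) : Set where
  constructor greedySpec
  field
    restores : insertAll (catMaybes bs) S′ ≡ S
    sorted   : Sorted S′
    steps    : All RowStep (zip as bs)
    rule     : AllPairs TripleRule (zip as bs)
    skipped  : All (λ z → All (Skips z) (zip as bs)) S′

greedyColumn-spec : ∀ as S → Sorted S →
  GreedySpec as S (proj₁ (greedyColumn as S)) (proj₂ (greedyColumn as S))
greedyColumn-spec [] S s = greedySpec refl s [] [] (All.tabulate (λ _ → []))
greedyColumn-spec (a ∷ as) S s with greedyColumn as S | greedyColumn-spec as S s
... | bs , S₁ | greedySpec e₁ s₁ steps rule skipped with pickAbove a S₁ | pickAbove-spec a S₁ s₁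
...   | nothing , S₂ | pickSpec refl step skipped′ s₂ =
        greedySpec e₁ s₂ (step ∷ steps) (All.tabulate (λ {q} _ → TripleRule-∞ a q) ∷ rule)
          (All.zipWith (λ (x , y) → x ∷ y) (skipped′ , skipped))
...   | just y , S₂ | pickSpec e step skipped′ s₂ =
        greedySpec (trans (insertAll-insert y (catMaybes bs) S₂) (trans (cong (insertAll (catMaybes bs)) e) e₁))
          s₂ (step ∷ steps) (proj₁ split ∷ rule) (All.zipWith (λ (x , y) → x ∷ y) (skipped′ , proj₂ split))
  where split = All-insert⁻ y S₂ (subst (All (λ z → All (Skips z) (zip as bs))) (sym e) skipped)

pickAbove-none : ∀ a S → All (λ z → Skips z (a , nothing)) S → pickAbove a S ≡ (nothing , S)
pickAbove-none nothing S h = refl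
pickAbove-none (just a) [] h = refl
pickAbove-none (just a) (x ∷ S) (hx ∷ h) with a <? x
... | yes a<x = ⊥-elim (Skips-∞⇒≮ hx a<x)
... | no _ rewrite pickAbove-none (just a) S h = refl

pickAbove-insert : ∀ {a y} S → a < y → Sorted S → All (λ z → Skips z (just a , just y)) S →
  pickAbove (just a) (insert y S) ≡ (just y , S)
pickAbove-insert {a} {y} [] a<y _ _ with a <? y
... | yes _ = refl
... | no a≮y = ⊥-elim (a≮y a<y)
pickAbove-insert {a} {y} (z ∷ S) a<y s (hz ∷ h) with y ≤? z
... | yes y≤z rewrite insert-≤ S y≤z with a <? y
...   | yes _ = refl
...   | no a≮y = ⊥-elim (a≮y a<y)
pickAbove-insert {a} {y} (z ∷ S) a<y s (hz ∷ h) | no y≰z rewrite insert-> S (≰⇒> y≰z) with a <? z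
...   | yes a<z = ⊥-elim (y≰z (Skips⇒≤ hz a<z))
...   | no _ rewrite pickAbove-insert S a<y (Linked.tail s) h = refl

greedyColumn-unique : ∀ ps → All RowStep ps → AllPairs TripleRule ps → ∀ S → Sorted S →
  All (λ z → All (Skips z) ps) S →
  greedyColumn (map proj₁ ps) (insertAll (catMaybes (map proj₂ ps)) S) ≡ (map proj₂ ps , S)
greedyColumn-unique [] _ _ S _ _ = refl
greedyColumn-unique ((a , nothing) ∷ ps) (_ ∷ steps) (_ ∷ rule) S s h
  rewrite greedyColumn-unique ps steps rule S s (All.map All.tail h)
        | pickAbove-none a S (All.map All.head h) = refl
greedyColumn-unique ((just a , just y) ∷ ps) (a<y ∷ steps) (r ∷ rule) S s h
  rewrite insertAll-insert y (catMaybes (map proj₂ ps)) S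
        | greedyColumn-unique ps steps rule (insert y S) (insert-↗ y s)
            (All-insert⁺ y S r (All.map All.tail h))
        | pickAbove-insert S a<y s (All.map All.head h) = refl

-- The counting form of column strictness

#≤ #< : ℕ → List ℕ → ℕ
#≤ y = count (_≤? y)
#< y = count (_<? y)

Fits : List ℕ → List ℕ → Set
Fits A B = ∀ y → #≤ y B ≤ #< y A

Fits-resp-↭ : ∀ {A A′ B B′} → A ↭ A′ → B ↭ B′ → Fits A B → Fits A′ B′
Fits-resp-↭ p q h y = subst₂ _≤_ (count-↭ (_≤? y) q) (count-↭ (_<? y) p) (h y)

#≤-gap : ∀ {a y} S → a ≤ y → All (λ z → a < z → y < z) S → #≤ y S ≡ #≤ a S
#≤-gap S a≤y h = count-cong (_≤? _) (_≤? _) (All.map both h)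
  where
  both : ∀ {z} → (_ < z → _ < z) → (z ≤ _ → z ≤ _) × (z ≤ _ → z ≤ _)
  both g = (λ z≤y → ≮⇒≥ (λ a<z → <⇒≱ (g a<z) z≤y)) , (λ z≤a → ≤-trans z≤a a≤y)

#<-mono : ∀ {a y} X → a ≤ y → #< a X ≤ #< y X
#<-mono X a≤y = count-mono (_<? _) (_<? _) {X} (All.tabulate (λ _ z<a → <-≤-trans z<a a≤y))

#≤-insertCell : ∀ y b S → #≤ y S ≤ #≤ y (insertCell b S)
#≤-insertCell y nothing S = ≤-refl
#≤-insertCell y (just x) S = ≤-trans (count-≤-∷ (_≤? y) x S) (≤-reflexive (sym (count-insert (_≤? y) x S)))

pickAbove-leftover : ∀ a X S → Sorted S → Fits (consCell a X) S → Fits X (proj₂ (pickAbove a S))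
pickAbove-leftover nothing X S s h = h
pickAbove-leftover (just a) X S s h y with pickAbove (just a) S | pickAbove-spec (just a) S s
... | b , S₂ | pickSpec e a<b skipped _ = go b e a<b skipped
  where
  open ≤-Reasoning
  shrink : ∀ y → #≤ y S₂ ≤ #≤ y S
  shrink y = ≤-trans (#≤-insertCell y b S₂) (≤-reflexive (cong (#≤ y) e))
  -- entries of S₂ above a are all above y, so nothing between a and y is lost
  gapped : a < y → All (λ z → a < z → y < z) S₂ → #≤ y S₂ ≤ #< y X
  gapped a<y g = begin
    #≤ y S₂       ≡⟨ #≤-gap S₂ (<⇒≤ a<y) g ⟩
    #≤ a S₂       ≤⟨ shrink a ⟩
    #≤ a S        ≤⟨ h a ⟩
    #< a (a ∷ X)  ≡⟨ count-reject (_<? a) X (<-irrefl refl) ⟩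
    #< a X        ≤⟨ #<-mono X (<⇒≤ a<y) ⟩
    #< y X        ∎
  go : ∀ b → insertCell b S₂ ≡ S → RowStep (just a , b) → All (λ z → Skips z (just a , b)) S₂ →
       #≤ y S₂ ≤ #< y X
  go b _ _ _ with a <? y
  go b _ _ _ | no a≮y = ≤-trans (shrink y) (≤-trans (h y) (≤-reflexive (count-reject (_<? y) X a≮y)))
  go nothing _ _ skipped | yes a<y = gapped a<y (All.map (λ sk a<z → ⊥-elim (Skips-∞⇒≮ sk a<z)) skipped)
  go (just x) e a<x skipped | yes a<y with x ≤? y
  ... | no x≰y = gapped a<y (All.map (λ sk a<z → <-≤-trans (≰⇒> x≰y) (Skips⇒≤ sk a<z)) skipped)
  ... | yes x≤y = ≤-pred (begin
    suc (#≤ y S₂)      ≡⟨ sym (count-accept (_≤? y) S₂ x≤y) ⟩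
    #≤ y (x ∷ S₂)      ≡⟨ sym (count-insert (_≤? y) x S₂) ⟩
    #≤ y (insert x S₂) ≡⟨ cong (#≤ y) e ⟩
    #≤ y S             ≤⟨ h y ⟩
    #< y (a ∷ X)       ≡⟨ count-accept (_<? y) X (<-≤-trans a<x x≤y) ⟩
    suc (#< y X)       ∎)

consCell-shift : ∀ a X L → X ++ consCell a L ↭ consCell a X ++ L
consCell-shift nothing X L = ↭-refl
consCell-shift (just a) X L = shift a X L

greedyColumn-leftover : ∀ as X S → Sorted S → Fits (X ++ catMaybes as) S →
  Fits X (proj₂ (greedyColumn as S))
greedyColumn-leftover [] X S s h = subst (λ A → Fits A S) (++-identityʳ X) h
greedyColumn-leftover (a ∷ as) X S s h =
  pickAbove-leftover a X _ (GreedySpec.sorted (greedyColumn-spec as S s))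
    (greedyColumn-leftover as (consCell a X) S s (Fits-resp-↭ {B = S} (consCell-shift a X (catMaybes as)) ↭-refl h))

Fits-[] : ∀ S → Fits [] S → S ≡ []
Fits-[] [] h = refl
Fits-[] (x ∷ S) h with subst (_≤ 0) (count-accept (_≤? x) S ≤-refl) (h x)
... | ()

greedyColumn-exhausts : ∀ as S → Sorted S → Fits (catMaybes as) S → proj₂ (greedyColumn as S) ≡ []
greedyColumn-exhausts as S s h = Fits-[] _ (greedyColumn-leftover as [] S s h)

#≤-above : ∀ {b y} B → y < b → Sorted (b ∷ B) → #≤ y B ≡ 0
#≤-above B y<b s = count-none (_≤? _) (All.map (λ b≤z z≤y → <⇒≱ y<b (≤-trans b≤z z≤y)) (sorted⇒All s))

ColStrict⇒Fits : ∀ A B → Sorted B → ColStrict A B → Fits A B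
ColStrict⇒Fits A [] s cs y = z≤n
ColStrict⇒Fits (a ∷ A) (b ∷ B) s (a<b , cs) y with b ≤? y
... | yes b≤y rewrite count-accept (_≤? y) B b≤y | count-accept (_<? y) A (<-≤-trans a<b b≤y) =
      s≤s (ColStrict⇒Fits A B (Linked.tail s) cs y)
... | no b≰y rewrite count-reject (_≤? y) B b≰y | #≤-above B (≰⇒> b≰y) s = z≤n

Fits⇒ColStrict : ∀ A B → Sorted A → Sorted B → Fits A B → ColStrict A B
Fits⇒ColStrict A [] sA sB h = tt
Fits⇒ColStrict [] (b ∷ B) sA sB h with subst (_≤ 0) (count-accept (_≤? b) B ≤-refl) (h b)
... | ()
Fits⇒ColStrict (a ∷ A) (b ∷ B) sA sB h = a<b , Fits⇒ColStrict A B (Linked.tail sA) (Linked.tail sB) h′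
  where
  a<b : a < b
  a<b with a <? b
  ... | yes a<b = a<b
  ... | no a≮b with subst₂ _≤_ (count-accept (_≤? b) B ≤-refl)
                      (trans (count-reject (_<? b) A a≮b)
                        (count-none (_<? b) (All.map (λ a≤z z<b → a≮b (≤-<-trans a≤z z<b)) (sorted⇒All sA))))
                      (h b)
  ... | ()
  h′ : Fits A B
  h′ y with b ≤? y
  ... | yes b≤y = ≤-pred (subst₂ _≤_ (count-accept (_≤? y) B b≤y) (count-accept (_<? y) A (<-≤-trans a<b b≤y)) (h y))
  ... | no b≰y rewrite #≤-above B (≰⇒> b≰y) sB = z≤n

RowSteps⇒Fits : ∀ ps → All RowStep ps → Fits (catMaybes (map proj₁ ps)) (catMaybes (map proj₂ ps))
RowSteps⇒Fits [] [] y = z≤n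
RowSteps⇒Fits ((a , nothing) ∷ ps) (_ ∷ steps) y with a
... | nothing = RowSteps⇒Fits ps steps y
... | just a′ = ≤-trans (RowSteps⇒Fits ps steps y) (count-≤-∷ (_<? y) a′ _)
RowSteps⇒Fits ((just a , just b) ∷ ps) (a<b ∷ steps) y with b ≤? y
... | yes b≤y rewrite count-accept (_≤? y) (catMaybes (map proj₂ ps)) b≤y
                    | count-accept (_<? y) (catMaybes (map proj₁ ps)) (<-≤-trans a<b b≤y) =
      s≤s (RowSteps⇒Fits ps steps y)
... | no b≰y rewrite count-reject (_≤? y) (catMaybes (map proj₂ ps)) b≰y =
      ≤-trans (RowSteps⇒Fits ps steps y) (count-≤-∷ (_<? y) a _)

nth-< : ∀ {X : Set} (xs : List X) i → i < length xs → ∃ λ x → nth xs i ≡ just x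
nth-< (x ∷ xs) zero _ = x , refl
nth-< (x ∷ xs) (suc i) (s≤s i<n) = nth-< xs i i<n

nth-just⇒< : ∀ {X : Set} (xs : List X) i {x} → nth xs i ≡ just x → i < length xs
nth-just⇒< (x ∷ xs) zero e = s≤s z≤n
nth-just⇒< (x ∷ xs) (suc i) e = s≤s (nth-just⇒< xs i e)

nth-≥ : ∀ {X : Set} (xs : List X) i → length xs ≤ i → nth xs i ≡ nothing
nth-≥ [] i _ = refl
nth-≥ (x ∷ xs) (suc i) (s≤s n≤i) = nth-≥ xs i n≤i

nth-map : ∀ {X Y : Set} (f : X → Y) xs i → nth (map f xs) i ≡ Maybe.map f (nth xs i)
nth-map f [] i = refl
nth-map f (x ∷ xs) zero = refl
nth-map f (x ∷ xs) (suc i) = nth-map f xs i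

nth-ext : ∀ {X : Set} (xs ys : List X) → (∀ i → nth xs i ≡ nth ys i) → xs ≡ ys
nth-ext [] [] h = refl
nth-ext [] (y ∷ ys) h with h 0
... | ()
nth-ext (x ∷ xs) [] h with h 0
... | ()
nth-ext (x ∷ xs) (y ∷ ys) h with h 0
... | refl = cong (x ∷_) (nth-ext xs ys (h ∘ suc))

nth-applyUpTo : ∀ {X : Set} (f : ℕ → X) n i → i < n → nth (applyUpTo f n) i ≡ just (f i)
nth-applyUpTo f (suc n) zero _ = refl
nth-applyUpTo f (suc n) (suc i) (s≤s i<n) = nth-applyUpTo (f ∘ suc) n i i<n

nth-applyUpTo-≥ : ∀ {X : Set} (f : ℕ → X) n i → n ≤ i → nth (applyUpTo f n) i ≡ nothing
nth-applyUpTo-≥ f zero i _ = refl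
nth-applyUpTo-≥ f (suc n) (suc i) (s≤s n≤i) = nth-applyUpTo-≥ (f ∘ suc) n i n≤i

applyUpTo-cong : ∀ {X : Set} {f g : ℕ → X} → (∀ k → f k ≡ g k) → ∀ n → applyUpTo f n ≡ applyUpTo g n
applyUpTo-cong h zero = refl
applyUpTo-cong h (suc n) = cong₂ _∷_ (h 0) (applyUpTo-cong (h ∘ suc) n)

applyUpTo-nth : ∀ {X : Set} (xs : List X) f → (∀ k {x} → nth xs k ≡ just x → f k ≡ x) → applyUpTo f (length xs) ≡ xs
applyUpTo-nth [] f h = refl
applyUpTo-nth (x ∷ xs) f h = cong₂ _∷_ (h 0 refl) (applyUpTo-nth xs (f ∘ suc) (h ∘ suc))

nth⇒All : ∀ {X : Set} {P : X → Set} xs → (∀ i {x} → nth xs i ≡ just x → P x) → All P xs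
nth⇒All [] h = []
nth⇒All (x ∷ xs) h = h 0 refl ∷ nth⇒All xs (h ∘ suc)

All⇒nth : ∀ {X : Set} {P : X → Set} {xs} → All P xs → ∀ i {x} → nth xs i ≡ just x → P x
All⇒nth (p ∷ ps) zero refl = p
All⇒nth (p ∷ ps) (suc i) e = All⇒nth ps i e

nth⇒AllPairs : ∀ {X : Set} {Q : X → X → Set} xs →
  (∀ i j {x y} → i < j → nth xs i ≡ just x → nth xs j ≡ just y → Q x y) → AllPairs Q xs
nth⇒AllPairs [] h = []
nth⇒AllPairs (x ∷ xs) h =
  nth⇒All xs (λ j → h 0 (suc j) (s≤s z≤n) refl) ∷ nth⇒AllPairs xs (λ i j i<j → h (suc i) (suc j) (s≤s i<j))

AllPairs⇒nth : ∀ {X : Set} {Q : X → X → Set} {xs} → AllPairs Q xs →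
  ∀ i j {x y} → i < j → nth xs i ≡ just x → nth xs j ≡ just y → Q x y
AllPairs⇒nth (h ∷ _) zero (suc j) _ refl e = All⇒nth h j e
AllPairs⇒nth (_ ∷ hs) (suc i) (suc j) (s≤s i<j) e e′ = AllPairs⇒nth hs i j i<j e e′

maxPart-lub : ∀ {x} xs → All (_≤ x) xs → maxPart xs ≤ x
maxPart-lub [] [] = z≤n
maxPart-lub (y ∷ xs) (y≤x ∷ h) = ⊔-lub y≤x (maxPart-lub xs h)

≤-maxPart : ∀ xs → All (_≤ maxPart xs) xs
≤-maxPart [] = []
≤-maxPart (y ∷ xs) = m≤m⊔n y _ ∷ All.map (λ p → ≤-trans p (m≤n⊔m y _)) (≤-maxPart xs)

column : ℕ → List (List ℕ) → List Cell
column k = map (λ r → nth r k)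

adjacentCells : ℕ → List (List ℕ) → List (Cell × Cell)
adjacentCells k = map (λ r → nth r k , nth r (suc k))

adjacentCells-proj₁ : ∀ k Tab → map proj₁ (adjacentCells k Tab) ≡ column k Tab
adjacentCells-proj₁ k [] = refl
adjacentCells-proj₁ k (r ∷ Tab) = cong (_ ∷_) (adjacentCells-proj₁ k Tab)

adjacentCells-proj₂ : ∀ k Tab → map proj₂ (adjacentCells k Tab) ≡ column (suc k) Tab
adjacentCells-proj₂ k [] = refl
adjacentCells-proj₂ k (r ∷ Tab) = cong (_ ∷_) (adjacentCells-proj₂ k Tab)

adjacentCells-zip : ∀ k Tab → adjacentCells k Tab ≡ zip (column k Tab) (column (suc k) Tab)
adjacentCells-zip k [] = refl
adjacentCells-zip k (r ∷ Tab) = cong (_ ∷_) (adjacentCells-zip k Tab)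

rowLength-≤-maxPart : ∀ (Tab : List (List ℕ)) i {r : List ℕ} → nth Tab i ≡ just r → length r ≤ maxPart (map length Tab)
rowLength-≤-maxPart Tab i e =
  All⇒nth (≤-maxPart (map length Tab)) i (trans (nth-map length Tab i) (cong (Maybe.map length) e))

module _ {P : Triple → Set} (ℓ m : ℕ) where

  All-triples⁻ : All P (triples ℓ m) →
    ∀ i d k → i < ℓ → d < ℓ ∸ suc i → k < m ∸ 1 → P (tri i (suc (i + d)) k)
  All-triples⁻ h i d k i<ℓ d<n k<m =
    All.applyUpTo⁻ id (m ∸ 1) (All.map⁻ (All.applyUpTo⁻ id (ℓ ∸ suc i)
      (All.map⁻ (All.concat⁻ (All.applyUpTo⁻ id ℓ (All.map⁻ (All.concat⁻ h)) i<ℓ))) d<n)) k<m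

  All-triples⁺ : (∀ i d k → i < ℓ → d < ℓ ∸ suc i → k < m ∸ 1 → P (tri i (suc (i + d)) k)) →
    All P (triples ℓ m)
  All-triples⁺ h =
    All.concat⁺ (All.map⁺ (All.applyUpTo⁺₁ id ℓ (λ {i} i<ℓ →
      All.concat⁺ (All.map⁺ (All.applyUpTo⁺₁ id (ℓ ∸ suc i) (λ {d} d<n →
        All.map⁺ (All.applyUpTo⁺₁ id (m ∸ 1) (λ {k} k<m → h i d k i<ℓ d<n k<m))))))))

Condition₃ : List (List ℕ) → Set
Condition₃ Tab = All (λ p → T (triple Tab (Triple.ti p) (Triple.tj p) (Triple.tk p)))
                     (triples (length (map length Tab)) (maxPart (map length Tab)))

entry-just : ∀ Tab i k {r} → nth Tab i ≡ just r → entry Tab i k ≡ nth r k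
entry-just Tab i k e with nth Tab i
entry-just Tab i k refl | just r = refl

triple≡TripleRule : ∀ Tab i j k {rᵢ rⱼ} → nth Tab i ≡ just rᵢ → nth Tab j ≡ just rⱼ →
  T (triple Tab i j k) ≡ TripleRule (nth rᵢ k , nth rᵢ (suc k)) (nth rⱼ k , nth rⱼ (suc k))
triple≡TripleRule Tab i j k eᵢ eⱼ
  rewrite entry-just Tab i (suc k) eᵢ | entry-just Tab j k eⱼ | entry-just Tab j (suc k) eⱼ = refl

nth-adjacentCells : ∀ k Tab i {q} → nth (adjacentCells k Tab) i ≡ just q →
  ∃ λ r → nth Tab i ≡ just r × (nth r k , nth r (suc k)) ≡ q
nth-adjacentCells k Tab i e = map-just (nth Tab i) (trans (sym (nth-map _ Tab i)) e)
  where
  map-just : ∀ {X Y : Set} {f : X → Y} mx {y} → Maybe.map f mx ≡ just y → ∃ λ x → mx ≡ just x × f x ≡ y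
  map-just (just x) refl = x , refl , refl

Condition₃⇒TripleRule : ∀ Tab → Condition₃ Tab → ∀ k → AllPairs TripleRule (adjacentCells k Tab)
Condition₃⇒TripleRule Tab h k = nth⇒AllPairs (adjacentCells k Tab) rule
  where
  ℓ = length (map length Tab)
  m = maxPart (map length Tab)
  m≤k+1 : ¬ k < m ∸ 1 → m ≤ suc k
  m≤k+1 k≮m = ≤-trans (m≤n+m∸n m 1) (s≤s (≮⇒≥ k≮m))
  rule : ∀ i j {x y} → i < j → nth (adjacentCells k Tab) i ≡ just x → nth (adjacentCells k Tab) j ≡ just y →
         TripleRule x y
  rule i j i<j eᵢ eⱼ with nth-adjacentCells k Tab i eᵢ | nth-adjacentCells k Tab j eⱼ
  ... | rᵢ , eᵢ′ , refl | rⱼ , eⱼ′ , refl with k <? m ∸ 1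
  ...   | yes k<m = subst id (triple≡TripleRule Tab i j k eᵢ′ eⱼ′)
            (subst (λ j′ → T (triple Tab i j′ k)) (m+[n∸m]≡n i<j)
              (All-triples⁻ ℓ m h i (j ∸ suc i) k (<-trans i<j j<ℓ) (∸-monoˡ-< j<ℓ i<j) k<m))
    where
    j<ℓ : j < ℓ
    j<ℓ = subst (j <_) (sym (length-map length Tab)) (nth-just⇒< Tab j eⱼ′)
  -- beyond the last column both right-hand cells are empty
  ...   | no k≮m rewrite nth-≥ rᵢ (suc k) (≤-trans (rowLength-≤-maxPart Tab i eᵢ′) (m≤k+1 k≮m))
                       | nth-≥ rⱼ (suc k) (≤-trans (rowLength-≤-maxPart Tab j eⱼ′) (m≤k+1 k≮m)) =
            TripleRule-∞ (nth rᵢ k) (nth rⱼ k , nothing)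

TripleRule⇒Condition₃ : ∀ Tab → (∀ k → AllPairs TripleRule (adjacentCells k Tab)) → Condition₃ Tab
TripleRule⇒Condition₃ Tab h = All-triples⁺ ℓ m rule
  where
  ℓ = length (map length Tab)
  m = maxPart (map length Tab)
  rule : ∀ i d k → i < ℓ → d < ℓ ∸ suc i → k < m ∸ 1 → T (triple Tab i (suc (i + d)) k)
  rule i d k i<ℓ d<n _
    with nth-< Tab i (subst (i <_) (length-map length Tab) i<ℓ)
       | nth-< Tab (suc (i + d)) (subst (suc (i + d) <_) (length-map length Tab) j<ℓ)
    where
    j<ℓ : suc (i + d) < ℓ
    j<ℓ = subst (_≤ ℓ) (cong suc (+-suc i d)) (subst (suc i + suc d ≤_) (m+[n∸m]≡n i<ℓ) (+-monoʳ-≤ (suc i) d<n))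
  ... | rᵢ , eᵢ | rⱼ , eⱼ = subst id (sym (triple≡TripleRule Tab i (suc (i + d)) k eᵢ eⱼ))
          (AllPairs⇒nth (h k) i (suc (i + d)) (s≤s (m≤m+n i d))
            (trans (nth-map _ Tab i) (cong (Maybe.map _) eᵢ))
            (trans (nth-map _ Tab (suc (i + d))) (cong (Maybe.map _) eⱼ)))


strict⇒RowStep : ∀ {r} → Linked _<_ r → ∀ k → RowStep (nth r k , nth r (suc k))
strict⇒RowStep [] k = tt
strict⇒RowStep [-] zero = tt
strict⇒RowStep [-] (suc k) = tt
strict⇒RowStep (x<y ∷ l) zero = x<y
strict⇒RowStep (x<y ∷ l) (suc k) = strict⇒RowStep l k

RowStep⇒strict : ∀ r → (∀ k → RowStep (nth r k , nth r (suc k))) → Linked _<_ r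
RowStep⇒strict [] h = []
RowStep⇒strict (x ∷ []) h = [-]
RowStep⇒strict (x ∷ y ∷ r) h = h 0 ∷ RowStep⇒strict (y ∷ r) (h ∘ suc)

strictRows⇒RowStep : ∀ {Tab} → All (Linked _<_) Tab → ∀ k → All RowStep (adjacentCells k Tab)
strictRows⇒RowStep [] k = []
strictRows⇒RowStep (l ∷ ls) k = strict⇒RowStep l k ∷ strictRows⇒RowStep ls k

RowStep⇒strictRows : ∀ Tab → (∀ k → All RowStep (adjacentCells k Tab)) → All (Linked _<_) Tab
RowStep⇒strictRows [] h = []
RowStep⇒strictRows (r ∷ Tab) h =
  RowStep⇒strict r (λ k → All.head (h k)) ∷ RowStep⇒strictRows Tab (λ k → All.tail (h k))

Supports : Cell → Cell → Set
Supports _ nothing = ⊤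
Supports (just _) (just _) = ⊤
Supports nothing (just _) = ⊥

Supports-∞ : ∀ c → Pointwise Supports c (replicate (length c) nothing)
Supports-∞ [] = []
Supports-∞ (x ∷ c) = tt ∷ Supports-∞ c

RowSteps⇒Supports : ∀ c d → length c ≡ length d → All RowStep (zip c d) → Pointwise Supports c d
RowSteps⇒Supports [] [] _ _ = []
RowSteps⇒Supports (x ∷ c) (nothing ∷ d) e (_ ∷ h) = tt ∷ RowSteps⇒Supports c d (suc-injective e) h
RowSteps⇒Supports (just _ ∷ c) (just _ ∷ d) e (_ ∷ h) = tt ∷ RowSteps⇒Supports c d (suc-injective e) h

fromColumns : ℕ → List (List Cell) → List (List ℕ)
fromColumns ℓ [] = replicate ℓ []
fromColumns ℓ (c ∷ cs) = zipWith consCell c (fromColumns ℓ cs)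

nthColumn : ℕ → List (List Cell) → ℕ → List Cell
nthColumn ℓ [] k = replicate ℓ nothing
nthColumn ℓ (c ∷ cs) zero = c
nthColumn ℓ (c ∷ cs) (suc k) = nthColumn ℓ cs k

WellFormed : ℕ → List (List Cell) → Set
WellFormed ℓ cs = All (λ c → length c ≡ ℓ) cs × Linked (Pointwise Supports) cs

column-replicate : ∀ k ℓ → column k (replicate ℓ []) ≡ replicate ℓ nothing
column-replicate k zero = refl
column-replicate zero (suc ℓ) = cong (nothing ∷_) (column-replicate zero ℓ)
column-replicate (suc k) (suc ℓ) = cong (nothing ∷_) (column-replicate (suc k) ℓ)

column-zero-consCells : ∀ c R → Pointwise Supports c (column 0 R) → column 0 (zipWith consCell c R) ≡ c
column-zero-consCells [] [] [] = refl
column-zero-consCells (just x ∷ c) (r ∷ R) (_ ∷ p) = cong (just x ∷_) (column-zero-consCells c R p)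
column-zero-consCells (nothing ∷ c) ([] ∷ R) (_ ∷ p) = cong (nothing ∷_) (column-zero-consCells c R p)

column-suc-consCells : ∀ k c R → Pointwise Supports c (column 0 R) →
  column (suc k) (zipWith consCell c R) ≡ column k R
column-suc-consCells k [] [] [] = refl
column-suc-consCells k (just x ∷ c) (r ∷ R) (_ ∷ p) = cong (nth r k ∷_) (column-suc-consCells k c R p)
column-suc-consCells k (nothing ∷ c) ([] ∷ R) (_ ∷ p) = cong (nothing ∷_) (column-suc-consCells k c R p)

column-fromColumns-∷ : ∀ ℓ c cs → Pointwise Supports c (column 0 (fromColumns ℓ cs)) →
  (∀ k → column k (fromColumns ℓ cs) ≡ nthColumn ℓ cs k) →
  ∀ k → column k (fromColumns ℓ (c ∷ cs)) ≡ nthColumn ℓ (c ∷ cs) k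
column-fromColumns-∷ ℓ c cs s ih zero = column-zero-consCells c (fromColumns ℓ cs) s
column-fromColumns-∷ ℓ c cs s ih (suc k) = trans (column-suc-consCells k c (fromColumns ℓ cs) s) (ih k)

column-fromColumns : ∀ ℓ cs → WellFormed ℓ cs → ∀ k → column k (fromColumns ℓ cs) ≡ nthColumn ℓ cs k
column-fromColumns ℓ [] _ k = column-replicate k ℓ
column-fromColumns ℓ (c ∷ []) (lc ∷ [] , _) =
  column-fromColumns-∷ ℓ c [] (subst (Pointwise Supports c) ∞-column (Supports-∞ c)) (λ k → column-replicate k ℓ)
  where
  ∞-column : replicate (length c) nothing ≡ column 0 (replicate ℓ [])
  ∞-column = trans (cong (λ n → replicate n nothing) lc) (sym (column-replicate 0 ℓ))
column-fromColumns ℓ (c ∷ c′ ∷ cs) (_ ∷ ls , s ∷ l) =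
  column-fromColumns-∷ ℓ c (c′ ∷ cs)
    (subst (Pointwise Supports c) (sym (column-fromColumns ℓ (c′ ∷ cs) (ls , l) 0)) s)
    (column-fromColumns ℓ (c′ ∷ cs) (ls , l))

-- The greedy composition tableau of an SSYT

sortedEntries : List Cell → List ℕ
sortedEntries c = insertAll (catMaybes c) []

greedyColumns : List Cell → List (List ℕ) → List (List Cell)
greedyColumns a [] = []
greedyColumns a (S ∷ Ss) = proj₁ (greedyColumn a S) ∷ greedyColumns (proj₁ (greedyColumn a S)) Ss

allColumns : List (List ℕ) → List (List Cell)
allColumns [] = []
allColumns (S ∷ Ss) = map just S ∷ greedyColumns (map just S) Ss

greedyTableau : List (List ℕ) → List (List ℕ)
greedyTableau [] = []
greedyTableau (S ∷ Ss) = fromColumns (length S) (allColumns (S ∷ Ss))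

length-greedyColumn : ∀ as S → length (proj₁ (greedyColumn as S)) ≡ length as
length-greedyColumn [] S = refl
length-greedyColumn (a ∷ as) S = cong suc (length-greedyColumn as S)

Adjacent : List Cell → List Cell → Set
Adjacent c d = All RowStep (zip c d) × AllPairs TripleRule (zip c d)

record GreedyColumnsSpec (a : List Cell) (Ss : List (List ℕ)) : Set where
  field
    lengths  : All (λ c → length c ≡ length a) (greedyColumns a Ss)
    supports : Linked (Pointwise Supports) (a ∷ greedyColumns a Ss)
    adjacent : Linked Adjacent (a ∷ greedyColumns a Ss)
    contents : Pointwise (λ c S → sortedEntries c ≡ S) (greedyColumns a Ss) Ss

greedyColumns-spec : ∀ a S Ss → sortedEntries a ≡ S → Linked ColStrict (S ∷ Ss) → All Sorted Ss →
  GreedyColumnsSpec a Ss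
greedyColumns-spec a S [] e _ _ = record { lengths = [] ; supports = [-] ; adjacent = [-] ; contents = [] }
greedyColumns-spec a S (S′ ∷ Ss) e (cs ∷ l) (s′ ∷ ss) = record
  { lengths = length-b ∷ All.map (λ p → trans p length-b) (GreedyColumnsSpec.lengths ih)
  ; supports = RowSteps⇒Supports a b (sym length-b) steps ∷ GreedyColumnsSpec.supports ih
  ; adjacent = (steps , rule) ∷ GreedyColumnsSpec.adjacent ih
  ; contents = e′ ∷ GreedyColumnsSpec.contents ih
  }
  where
  b = proj₁ (greedyColumn a S′)
  length-b = length-greedyColumn a S′
  open GreedySpec (greedyColumn-spec a S′ s′)
  fits : Fits (catMaybes a) S′
  fits = Fits-resp-↭ {B = S′} (subst (_↭ catMaybes a) e (insertAll-[]-↭ (catMaybes a))) ↭-refl (ColStrict⇒Fits S S′ s′ cs)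
  e′ : sortedEntries b ≡ S′
  e′ = trans (cong (insertAll (catMaybes b)) (sym (greedyColumn-exhausts a S′ s′ fits))) restores
  ih = greedyColumns-spec b S′ Ss e′ l ss

Adjacent-∞ : ∀ c → Adjacent c (replicate (length c) nothing)
Adjacent-∞ [] = [] , []
Adjacent-∞ (x ∷ c) = tt ∷ proj₁ (Adjacent-∞ c) , rule c ∷ proj₂ (Adjacent-∞ c)
  where
  rule : ∀ c → All (TripleRule (x , nothing)) (zip c (replicate (length c) nothing))
  rule [] = []
  rule (y ∷ c) = TripleRule-∞ x (y , nothing) ∷ rule c

Adjacent-nthColumn : ∀ ℓ cs → Linked Adjacent cs → All (λ c → length c ≡ ℓ) cs →
  ∀ k → Adjacent (nthColumn ℓ cs k) (nthColumn ℓ cs (suc k))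
Adjacent-nthColumn ℓ [] _ _ k =
  subst (λ n → Adjacent (replicate ℓ nothing) (replicate n nothing)) (length-replicate ℓ) (Adjacent-∞ _)
Adjacent-nthColumn ℓ (c ∷ []) _ (lc ∷ _) zero = subst (λ n → Adjacent c (replicate n nothing)) lc (Adjacent-∞ c)
Adjacent-nthColumn ℓ (c ∷ []) _ _ (suc k) = Adjacent-nthColumn ℓ [] [] [] k
Adjacent-nthColumn ℓ (c ∷ c′ ∷ cs) (q ∷ _) _ zero = q
Adjacent-nthColumn ℓ (c ∷ c′ ∷ cs) (_ ∷ l) (_ ∷ ls) (suc k) = Adjacent-nthColumn ℓ (c′ ∷ cs) l ls k

Pointwise-nthColumn : ∀ {P : List Cell → List ℕ → Set} ℓ {cs Ss} → Pointwise P cs Ss →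
  ∀ k {S} → nth Ss k ≡ just S → P (nthColumn ℓ cs k) S
Pointwise-nthColumn ℓ (p ∷ ps) zero refl = p
Pointwise-nthColumn ℓ (p ∷ ps) (suc k) e = Pointwise-nthColumn ℓ ps k e

nthColumn-≥ : ∀ ℓ cs k → length cs ≤ k → nthColumn ℓ cs k ≡ replicate ℓ nothing
nthColumn-≥ ℓ [] k _ = refl
nthColumn-≥ ℓ (c ∷ cs) (suc k) (s≤s n≤k) = nthColumn-≥ ℓ cs k n≤k

record SSYTRows (S : List (List ℕ)) : Set where
  field
    sorted    : All Sorted S
    colStrict : Linked ColStrict S

module GreedyTableau (S₀ : List ℕ) (Ss : List (List ℕ)) (rows : SSYTRows (S₀ ∷ Ss)) where

  private
    S = S₀ ∷ Ss
    ℓ = length S₀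
    cs = allColumns S

    content₀ : sortedEntries (map just S₀) ≡ S₀
    content₀ = trans (cong (λ xs → insertAll xs []) (mapMaybe-just S₀))
                     (insertAll-sorted S₀ (All.head (SSYTRows.sorted rows)))

    spec : GreedyColumnsSpec (map just S₀) Ss
    spec = greedyColumns-spec (map just S₀) S₀ Ss content₀
             (SSYTRows.colStrict rows) (All.tail (SSYTRows.sorted rows))
    open GreedyColumnsSpec spec

    lengths′ : All (λ c → length c ≡ ℓ) cs
    lengths′ = length-map just S₀ ∷ All.map (λ p → trans p (length-map just S₀)) lengths

  columns : ∀ k → column k (greedyTableau S) ≡ nthColumn ℓ cs k
  columns = column-fromColumns ℓ cs (lengths′ , supports)

  adjacentColumns : ∀ k → Adjacent (column k (greedyTableau S)) (column (suc k) (greedyTableau S))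
  adjacentColumns k rewrite columns k | columns (suc k) = Adjacent-nthColumn ℓ cs adjacent lengths′ k

  columnContents : ∀ k {Sₖ} → nth S k ≡ just Sₖ → sortedEntries (column k (greedyTableau S)) ≡ Sₖ
  columnContents zero refl rewrite columns 0 = content₀
  columnContents (suc k) e rewrite columns (suc k) = Pointwise-nthColumn ℓ contents k e

  columns-≥ : ∀ k → length S ≤ k → column k (greedyTableau S) ≡ replicate ℓ nothing
  columns-≥ k n≤k rewrite columns k =
    nthColumn-≥ ℓ cs k (subst (_≤ k) (sym (cong suc (Pointwise-length contents))) n≤k)

  column₀ : column 0 (greedyTableau S) ≡ map just S₀
  column₀ = columns 0


nthColumn-applyUpTo : ∀ ℓ n (c : ℕ → List Cell) k → k < n → nthColumn ℓ (applyUpTo c n) k ≡ c k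
nthColumn-applyUpTo ℓ (suc n) c zero _ = refl
nthColumn-applyUpTo ℓ (suc n) c (suc k) (s≤s k<n) = nthColumn-applyUpTo ℓ n (c ∘ suc) k k<n

-- The SSYT of a composition tableau

catMaybes-∞ : ∀ ℓ → catMaybes (replicate ℓ (nothing {A = ℕ})) ≡ []
catMaybes-∞ zero = refl
catMaybes-∞ (suc ℓ) = catMaybes-∞ ℓ

sortColumns : List (List ℕ) → List (List ℕ)
sortColumns Tab = applyUpTo (λ k → sortedEntries (column k Tab)) (maxPart (map length Tab))

column-≥ : ∀ Tab k → maxPart (map length Tab) ≤ k → column k Tab ≡ replicate (length Tab) nothing
column-≥ [] k _ = refl
column-≥ (r ∷ Tab) k m≤k rewrite nth-≥ r k (m⊔n≤o⇒m≤o (length r) _ m≤k) =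
  cong (nothing ∷_) (column-≥ Tab k (m⊔n≤o⇒n≤o (length r) _ m≤k))

column-empty⇒≤ : ∀ Tab k → catMaybes (column k Tab) ≡ [] → maxPart (map length Tab) ≤ k
column-empty⇒≤ [] k e = z≤n
column-empty⇒≤ (r ∷ Tab) k e with k <? length r
... | yes k<n with nth-< r k k<n
...   | x , eₓ rewrite eₓ with e
...     | ()
column-empty⇒≤ (r ∷ Tab) k e | no k≮n with nth r k
... | nothing = ⊔-lub (≮⇒≥ k≮n) (column-empty⇒≤ Tab k e)
... | just x with e
...   | ()

NonEmptyRows : List (List ℕ) → Set
NonEmptyRows = All (λ r → 1 ≤ length r)

sortColumns-greedyTableau : ∀ S → SSYTRows S → NonEmptyRows S → sortColumns (greedyTableau S) ≡ S
sortColumns-greedyTableau [] _ _ = refl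
sortColumns-greedyTableau (S₀ ∷ Ss) rows nonempty =
  trans (cong (applyUpTo rowₖ) maxPart≡) (applyUpTo-nth S rowₖ columnContents)
  where
  open GreedyTableau S₀ Ss rows
  S = S₀ ∷ Ss
  Tab = greedyTableau S
  n = length Ss
  rowₖ = λ k → sortedEntries (column k Tab)
  maxPart≤ : maxPart (map length Tab) ≤ suc n
  maxPart≤ = column-empty⇒≤ Tab (suc n)
    (trans (cong catMaybes (columns-≥ (suc n) ≤-refl)) (catMaybes-∞ (length S₀)))
  -- the top row of S is nonempty, so column n of the tableau is not empty
  maxPart> : n < maxPart (map length Tab)
  maxPart> with nth-< S n ≤-refl
  ... | Sₙ , eₙ = ≰⇒> λ m≤n → <⇒≱ (All⇒nth nonempty n eₙ) (≤-reflexive (cong length (empty m≤n)))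
    where
    empty : maxPart (map length Tab) ≤ n → Sₙ ≡ []
    empty m≤n = trans (sym (columnContents n eₙ))
                  (cong (λ xs → insertAll xs []) (trans (cong catMaybes (column-≥ Tab n m≤n)) (catMaybes-∞ (length Tab))))
  maxPart≡ : maxPart (map length Tab) ≡ suc n
  maxPart≡ = ≤-antisym maxPart≤ maxPart>

column-ext : ∀ Tab Tab′ → (∀ k → column k Tab ≡ column k Tab′) → Tab ≡ Tab′
column-ext [] [] h = refl
column-ext [] (r ∷ Tab′) h with h 0
... | ()
column-ext (r ∷ Tab) [] h with h 0
... | ()
column-ext (r ∷ Tab) (r′ ∷ Tab′) h =
  cong₂ _∷_ (nth-ext r r′ (λ k → ∷-injectiveˡ (h k))) (column-ext Tab Tab′ (λ k → ∷-injectiveʳ (h k)))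

greedyColumns-applyUpTo : ∀ n (c : ℕ → List Cell) (S : ℕ → List ℕ) →
  (∀ k → proj₁ (greedyColumn (c k) (S k)) ≡ c (suc k)) →
  greedyColumns (c 0) (applyUpTo S n) ≡ applyUpTo (c ∘ suc) n
greedyColumns-applyUpTo zero c S h = refl
greedyColumns-applyUpTo (suc n) c S h rewrite h 0 =
  cong (c 1 ∷_) (greedyColumns-applyUpTo n (c ∘ suc) (S ∘ suc) (h ∘ suc))

-- Only applied to nonempty rows.
firstEntry : List ℕ → ℕ
firstEntry [] = 0
firstEntry (x ∷ _) = x

column₀-firstEntry : ∀ Tab → NonEmptyRows Tab → column 0 Tab ≡ map just (map firstEntry Tab)
column₀-firstEntry [] _ = refl
column₀-firstEntry ((x ∷ r) ∷ Tab) (_ ∷ ne) = cong (just x ∷_) (column₀-firstEntry Tab ne)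
column₀-firstEntry ([] ∷ Tab) (() ∷ _)

FirstLe⇒sorted : ∀ Tab → NonEmptyRows Tab → Linked FirstLe Tab → Sorted (map firstEntry Tab)
FirstLe⇒sorted [] _ _ = []
FirstLe⇒sorted (r ∷ []) _ _ = [-]
FirstLe⇒sorted ((x ∷ r) ∷ (y ∷ r′) ∷ Tab) (_ ∷ ne) (x≤y ∷ l) = x≤y ∷ FirstLe⇒sorted ((y ∷ r′) ∷ Tab) ne l
FirstLe⇒sorted ([] ∷ _ ∷ _) (() ∷ _) _
FirstLe⇒sorted ((x ∷ r) ∷ [] ∷ _) (_ ∷ () ∷ _) _

sorted⇒FirstLe : ∀ Tab → NonEmptyRows Tab → Sorted (map firstEntry Tab) → Linked FirstLe Tab
sorted⇒FirstLe [] _ _ = []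
sorted⇒FirstLe (r ∷ []) _ _ = [-]
sorted⇒FirstLe ((x ∷ r) ∷ (y ∷ r′) ∷ Tab) (_ ∷ ne) (x≤y ∷ s) = x≤y ∷ sorted⇒FirstLe ((y ∷ r′) ∷ Tab) ne s
sorted⇒FirstLe ([] ∷ _ ∷ _) (() ∷ _) _
sorted⇒FirstLe ((x ∷ r) ∷ [] ∷ _) (_ ∷ () ∷ _) _

-- Conditions (1)–(3) on a composition tableau, read column by column.
record ColumnConditions (Tab : List (List ℕ)) : Set where
  field
    nonempty    : NonEmptyRows Tab
    firstColumn : Linked FirstLe Tab
    rowSteps    : ∀ k → All RowStep (adjacentCells k Tab)
    tripleRule  : ∀ k → AllPairs TripleRule (adjacentCells k Tab)

module SortColumns (Tab : List (List ℕ)) (conditions : ColumnConditions Tab) where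

  open ColumnConditions conditions

  rowₖ : ℕ → List ℕ
  rowₖ k = sortedEntries (column k Tab)

  greedy-column : ∀ k → proj₁ (greedyColumn (column k Tab) (rowₖ (suc k))) ≡ column (suc k) Tab
  greedy-column k = subst₂ (λ c d → proj₁ (greedyColumn c (sortedEntries d)) ≡ d)
    (adjacentCells-proj₁ k Tab) (adjacentCells-proj₂ k Tab)
    (cong proj₁ (greedyColumn-unique (adjacentCells k Tab) (rowSteps k) (tripleRule k) [] [] []))

  fits : ∀ k → Fits (rowₖ k) (rowₖ (suc k))
  fits k = Fits-resp-↭ (↭-sym (insertAll-[]-↭ (catMaybes (column k Tab))))
                       (↭-sym (insertAll-[]-↭ (catMaybes (column (suc k) Tab))))
    (subst₂ (λ c d → Fits (catMaybes c) (catMaybes d)) (adjacentCells-proj₁ k Tab) (adjacentCells-proj₂ k Tab)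
      (RowSteps⇒Fits (adjacentCells k Tab) (rowSteps k)))

  ssytRows : SSYTRows (sortColumns Tab)
  ssytRows = record
    { sorted = All.applyUpTo⁺₂ rowₖ _ (λ k → insertAll-↗ (catMaybes (column k Tab)) [])
    ; colStrict = Linked.applyUpTo⁺₂ rowₖ _ (λ k →
        Fits⇒ColStrict (rowₖ k) (rowₖ (suc k))
          (insertAll-↗ (catMaybes (column k Tab)) []) (insertAll-↗ (catMaybes (column (suc k) Tab)) []) (fits k))
    }

greedyTableau-sortColumns : ∀ Tab → ColumnConditions Tab → greedyTableau (sortColumns Tab) ≡ Tab
greedyTableau-sortColumns [] _ = refl
greedyTableau-sortColumns (r ∷ Tab′) conditions
  with maxPart (map length (r ∷ Tab′)) in eq
... | zero = ⊥-elim (<⇒≱ (All.head nonempty) (subst (length r ≤_) eq (m≤m⊔n (length r) _)))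
  where open ColumnConditions conditions
... | suc m = column-ext (greedyTableau S) Tab (λ k → trans (columns k) (nthColumn≡column k))
  where
  Tab = r ∷ Tab′
  open ColumnConditions conditions
  open SortColumns Tab conditions
  S₀ = rowₖ 0
  S = S₀ ∷ applyUpTo (rowₖ ∘ suc) m
  firsts = map firstEntry Tab
  column₀≡ : column 0 Tab ≡ map just firsts
  column₀≡ = column₀-firstEntry Tab nonempty
  S₀≡firsts : S₀ ≡ firsts
  S₀≡firsts = trans (cong sortedEntries column₀≡)
    (trans (cong (λ xs → insertAll xs []) (mapMaybe-just firsts))
      (insertAll-sorted firsts (FirstLe⇒sorted Tab nonempty firstColumn)))
  rows : SSYTRows S
  rows = subst SSYTRows (cong (λ n → applyUpTo rowₖ n) eq) ssytRows
  open GreedyTableau S₀ (applyUpTo (rowₖ ∘ suc) m) rows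
  allColumns≡ : allColumns S ≡ applyUpTo (λ k → column k Tab) (suc m)
  allColumns≡ rewrite S₀≡firsts | sym column₀≡ =
    cong (column 0 Tab ∷_) (greedyColumns-applyUpTo m (λ k → column k Tab) (rowₖ ∘ suc) greedy-column)
  length-S₀ : length S₀ ≡ length Tab
  length-S₀ = trans (cong length S₀≡firsts) (length-map firstEntry Tab)
  nthColumn≡column : ∀ k → nthColumn (length S₀) (allColumns S) k ≡ column k Tab
  nthColumn≡column k rewrite allColumns≡ with k <? suc m
  ... | yes k<m = nthColumn-applyUpTo (length S₀) (suc m) (λ k → column k Tab) k k<m
  ... | no k≮m rewrite nthColumn-≥ (length S₀) (applyUpTo (λ k → column k Tab) (suc m)) k
                         (subst (_≤ k) (sym (length-applyUpTo (λ k → column k Tab) (suc m))) (≮⇒≥ k≮m)) | length-S₀ =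
        sym (column-≥ Tab k (subst (_≤ k) (sym eq) (≮⇒≥ k≮m)))

concat-↭ : ∀ (f g : ℕ → List ℕ) n → (∀ k → f k ↭ g k) → concat (applyUpTo f n) ↭ concat (applyUpTo g n)
concat-↭ f g zero h = ↭-refl
concat-↭ f g (suc n) h = ++⁺ (h 0) (concat-↭ (f ∘ suc) (g ∘ suc) n (h ∘ suc))

concat-++ : ∀ (f g : ℕ → List ℕ) n →
  concat (applyUpTo (λ k → f k ++ g k) n) ↭ concat (applyUpTo f n) ++ concat (applyUpTo g n)
concat-++ f g zero = ↭-refl
concat-++ f g (suc n) = begin
  (f 0 ++ g 0) ++ concat (applyUpTo (λ k → f (suc k) ++ g (suc k)) n)
    ↭⟨ ++⁺ˡ (f 0 ++ g 0) (concat-++ (f ∘ suc) (g ∘ suc) n) ⟩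
  (f 0 ++ g 0) ++ (F ++ G)   ≡⟨ ++-assoc (f 0) (g 0) (F ++ G) ⟩
  f 0 ++ (g 0 ++ (F ++ G))   ↭⟨ ++⁺ˡ (f 0) (shifts (g 0) F) ⟩
  f 0 ++ (F ++ (g 0 ++ G))   ≡⟨ sym (++-assoc (f 0) F (g 0 ++ G)) ⟩
  (f 0 ++ F) ++ (g 0 ++ G)   ∎
  where
  open PermutationReasoning
  F = concat (applyUpTo (f ∘ suc) n)
  G = concat (applyUpTo (g ∘ suc) n)

catMaybes-∷ : ∀ (x : Cell) c → catMaybes (x ∷ c) ≡ fromMaybe x ++ catMaybes c
catMaybes-∷ nothing c = refl
catMaybes-∷ (just x) c = refl

concat-row : ∀ (r : List ℕ) n → length r ≤ n → concat (applyUpTo (λ k → fromMaybe (nth r k)) n) ≡ r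
concat-row [] zero _ = refl
concat-row [] (suc n) _ = concat-row [] n z≤n
concat-row (x ∷ r) (suc n) (s≤s r≤n) = cong (x ∷_) (concat-row r n r≤n)

concat-columns : ∀ Tab n → maxPart (map length Tab) ≤ n →
  concat (applyUpTo (λ k → catMaybes (column k Tab)) n) ↭ concat Tab
concat-columns [] n _ = ↭-reflexive (empty n)
  where
  empty : ∀ n → concat (applyUpTo (λ k → catMaybes (column k [])) n) ≡ []
  empty zero = refl
  empty (suc n) = empty n
concat-columns (r ∷ Tab) n m≤n = begin
  concat (applyUpTo (λ k → catMaybes (column k (r ∷ Tab))) n)
    ≡⟨ cong concat (applyUpTo-cong (λ k → catMaybes-∷ (nth r k) (column k Tab)) n) ⟩
  concat (applyUpTo (λ k → fromMaybe (nth r k) ++ catMaybes (column k Tab)) n)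
    ↭⟨ concat-++ (λ k → fromMaybe (nth r k)) (λ k → catMaybes (column k Tab)) n ⟩
  concat (applyUpTo (λ k → fromMaybe (nth r k)) n) ++ concat (applyUpTo (λ k → catMaybes (column k Tab)) n)
    ↭⟨ ++⁺ (↭-reflexive (concat-row r n (m⊔n≤o⇒m≤o (length r) _ m≤n)))
           (concat-columns Tab n (m⊔n≤o⇒n≤o (length r) _ m≤n)) ⟩
  r ++ concat Tab ∎
  where open PermutationReasoning

concat-sortColumns : ∀ Tab → concat (sortColumns Tab) ↭ concat Tab
concat-sortColumns Tab =
  ↭-trans (concat-↭ _ _ (maxPart (map length Tab)) (λ k → insertAll-[]-↭ (catMaybes (column k Tab))))
          (concat-columns Tab (maxPart (map length Tab)) ≤-refl)

sum-length-filter : ∀ {P : Pred ℕ 0ℓ} (P? : Decidable P) Tab →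
  sum (map (λ r → length (filter P? r)) Tab) ≡ length (filter P? (concat Tab))
sum-length-filter P? [] = refl
sum-length-filter P? (r ∷ Tab) =
  trans (cong (length (filter P? r) +_) (sum-length-filter P? Tab)) (sym (count-++ P? r (concat Tab)))

HasWeight-↭ : ∀ v Tab Tab′ → concat Tab ↭ concat Tab′ → HasWeight v Tab → HasWeight v Tab′
HasWeight-↭ v Tab Tab′ p (bounded , weight) =
  All.concat⁻ (All-resp-↭ p (All.concat⁺ bounded)) ,
  trans (map-cong (λ i → trans (sum-length-filter (λ x → suc i ≟ x) Tab′)
                    (trans (sym (count-↭ (λ x → suc i ≟ x) p)) (sym (sum-length-filter (λ x → suc i ≟ x) Tab))))
                  (upTo (length v)))
        weight

PositiveEntries-↭ : ∀ Tab Tab′ → concat Tab ↭ concat Tab′ → PositiveEntries Tab → PositiveEntries Tab′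
PositiveEntries-↭ Tab Tab′ p h = All.concat⁻ (All-resp-↭ p (All.concat⁺ h))

-- Conjugate partitions

#≥ : ℕ → List ℕ → ℕ
#≥ j = count (j ≤?_)

conj-applyUpTo : ∀ α → conj α ≡ applyUpTo (λ i → #≥ (suc i) α) (maxPart α)
conj-applyUpTo α = map-upTo _ (maxPart α)

length-column : ∀ k Tab → length (catMaybes (column k Tab)) ≡ #≥ (suc k) (map length Tab)
length-column k [] = refl
length-column k (r ∷ Tab) with suc k ≤? length r
... | yes k<n with nth-< r k k<n
...   | x , eₓ rewrite eₓ | count-accept (suc k ≤?_) (map length Tab) k<n = cong suc (length-column k Tab)
length-column k (r ∷ Tab) | no k≮n rewrite nth-≥ r k (≮⇒≥ k≮n) | count-reject (suc k ≤?_) (map length Tab) k≮n =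
  length-column k Tab

shape-sortColumns : ∀ Tab → map length (sortColumns Tab) ≡ conj (map length Tab)
shape-sortColumns Tab = begin
  map length (sortColumns Tab)
    ≡⟨ map-applyUpTo _ length (maxPart (map length Tab)) ⟩
  applyUpTo (λ k → length (sortedEntries (column k Tab))) (maxPart (map length Tab))
    ≡⟨ applyUpTo-cong (λ k → trans (↭-length (insertAll-[]-↭ (catMaybes (column k Tab)))) (length-column k Tab)) _ ⟩
  applyUpTo (λ k → #≥ (suc k) (map length Tab)) (maxPart (map length Tab))
    ≡⟨ sym (conj-applyUpTo (map length Tab)) ⟩
  conj (map length Tab) ∎
  where open ≡-Reasoning

maxPart-↭ : ∀ {α β} → α ↭ β → maxPart α ≡ maxPart β
maxPart-↭ p = foldr-commMonoid (setoid ℕ) ⊔-0-isCommutativeMonoid (↭⇒↭ₛ p)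

conj-↭ : ∀ {α β} → α ↭ β → conj α ≡ conj β
conj-↭ {α} {β} p rewrite conj-applyUpTo α | conj-applyUpTo β | maxPart-↭ p =
  applyUpTo-cong (λ i → count-↭ (suc i ≤?_) p) (maxPart β)

shape-↭ : ∀ α → shape α ↭ α
shape-↭ α = ↭-trans (↭-reverse (sort α)) (sort-↭ α)

reverse-ascending : ∀ xs → AllPairs _≤_ xs → AllPairs _≥_ (reverse xs)
reverse-ascending [] _ = []
reverse-ascending (x ∷ xs) (h ∷ hs) rewrite unfold-reverse x xs =
  AllPairs.++⁺ (reverse-ascending xs hs) ([] ∷ []) (All-resp-↭ (↭-sym (↭-reverse xs)) (All.map (_∷ []) h))

shape-isPartition : ∀ α → IsComposition α → IsPartition (shape α)
shape-isPartition α c =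
  All-resp-↭ (↭-sym (shape-↭ α)) c ,
  AllPairs⇒Linked (reverse-ascending (sort α) (Linked⇒AllPairs ≤-trans (sort-↗ α)))

Decreasing : List ℕ → Set
Decreasing = Linked _≥_

Decreasing⇒≤head : ∀ {q μ} → Decreasing (q ∷ μ) → All (_≤ q) μ
Decreasing⇒≤head [-] = []
Decreasing⇒≤head (q≥x ∷ l) = Linked⇒All (λ x≥y y≥z → ≤-trans y≥z x≥y) q≥x l

#≥-beyond : ∀ {j q} μ → Decreasing (q ∷ μ) → ¬ j ≤ q → #≥ j μ ≡ 0
#≥-beyond μ l j≰q = count-none (_ ≤?_) (All.map (λ x≤q j≤x → j≰q (≤-trans j≤x x≤q)) (Decreasing⇒≤head l))

-- Cell (i, k) lies in the diagram of μ iff it lies in the diagram of its conjugate.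
diagram-symmetric : ∀ μ → Decreasing μ → ∀ i {p} → nth μ i ≡ just p → ∀ k →
  suc i ≤ #≥ (suc k) μ ⇔ suc k ≤ p
diagram-symmetric (q ∷ μ) l zero refl k with suc k ≤? q
... | yes k<q = mk⇔ (λ _ → k<q) (λ _ → subst (1 ≤_) (sym (count-accept (suc k ≤?_) μ k<q)) (s≤s z≤n))
... | no k≮q = mk⇔ (λ h → ⊥-elim (<⇒≱ h (≤-reflexive (trans (count-reject (suc k ≤?_) μ k≮q) (#≥-beyond μ l k≮q)))))
                   (λ k<q → ⊥-elim (k≮q k<q))
diagram-symmetric (q ∷ μ) l (suc i) e k with suc k ≤? q | diagram-symmetric μ (Linked.tail l) i e k
... | yes k<q | ih rewrite count-accept (suc k ≤?_) μ k<q = mk⇔ (Equivalence.to ih ∘ ≤-pred) (s≤s ∘ Equivalence.from ih)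
... | no k≮q | _ rewrite count-reject (suc k ≤?_) μ k≮q | #≥-beyond μ l k≮q =
      mk⇔ (λ ()) (λ k<p → ⊥-elim (k≮q (≤-trans k<p (All⇒nth (Decreasing⇒≤head l) i e))))

count-applyUpTo : ∀ {P : Pred ℕ 0ℓ} (P? : Decidable P) n (f : ℕ → ℕ) {p} →
  (∀ k → P (f k) ⇔ k < p) → p ≤ n → count P? (applyUpTo f n) ≡ p
count-applyUpTo P? zero f h z≤n = refl
count-applyUpTo P? (suc n) f {zero} h _ =
  count-none P? (All.applyUpTo⁺₂ f (suc n) (λ k pk → <⇒≱ (Equivalence.to (h k) pk) z≤n))
count-applyUpTo P? (suc n) f {suc p} h (s≤s p≤n)
  rewrite count-accept P? (applyUpTo (f ∘ suc) n) (Equivalence.from (h 0) (s≤s z≤n)) =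
  cong suc (count-applyUpTo P? n (f ∘ suc)
    (λ k → mk⇔ (≤-pred ∘ Equivalence.to (h (suc k))) (Equivalence.from (h (suc k)) ∘ s≤s)) p≤n)

conj-involutive : ∀ μ → IsPartition μ → conj (conj μ) ≡ μ
conj-involutive μ (positive , decreasing) = nth-ext (conj ν) μ part
  where
  ν = conj μ
  ν≡ : ν ≡ applyUpTo (λ k → #≥ (suc k) μ) (maxPart μ)
  ν≡ = conj-applyUpTo μ
  part : ∀ i → nth (conj ν) i ≡ nth μ i
  part i rewrite conj-applyUpTo ν with i <? length μ
  ... | no i≮n = trans (nth-applyUpTo-≥ _ (maxPart ν) i maxPart≤i) (sym (nth-≥ μ i (≮⇒≥ i≮n)))
    where
    maxPart≤i : maxPart ν ≤ i
    maxPart≤i = maxPart-lub ν (subst (All (_≤ i)) (sym ν≡)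
      (All.applyUpTo⁺₂ _ (maxPart μ) (λ k → ≤-trans (length-filter (suc k ≤?_) μ) (≮⇒≥ i≮n))))
  ... | yes i<n with nth-< μ i i<n
  ...   | p , eₚ rewrite eₚ = trans (nth-applyUpTo _ (maxPart ν) i i<maxPart) (cong just #≥≡p)
    where
    symmetric = diagram-symmetric μ decreasing i eₚ
    p≤maxPart : p ≤ maxPart μ
    p≤maxPart = All⇒nth (≤-maxPart μ) i eₚ
    i<maxPart : i < maxPart ν
    i<maxPart = ≤-trans (Equivalence.from (symmetric 0) (All⇒nth positive i eₚ))
      (All⇒nth (≤-maxPart ν) 0
        (trans (cong (λ xs → nth xs 0) ν≡) (nth-applyUpTo _ (maxPart μ) 0 (≤-trans (All⇒nth positive i eₚ) p≤maxPart))))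
    #≥≡p : #≥ (suc i) ν ≡ p
    #≥≡p = trans (cong (#≥ (suc i)) ν≡) (count-applyUpTo (suc i ≤?_) (maxPart μ) _ symmetric p≤maxPart)

-- The bijection

column₀⇒NonEmptyRows : ∀ Tab L → column 0 Tab ≡ map just L → NonEmptyRows Tab
column₀⇒NonEmptyRows [] L e = []
column₀⇒NonEmptyRows ((y ∷ r) ∷ Tab) (x ∷ L) e = s≤s z≤n ∷ column₀⇒NonEmptyRows Tab L (∷-injectiveʳ e)

column₀⇒FirstLe : ∀ Tab L → column 0 Tab ≡ map just L → Sorted L → Linked FirstLe Tab
column₀⇒FirstLe Tab L e s = sorted⇒FirstLe Tab nonempty (subst Sorted L≡firsts s)
  where
  nonempty = column₀⇒NonEmptyRows Tab L e
  L≡firsts : L ≡ map firstEntry Tab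
  L≡firsts = map-injective just-injective (trans (sym e) (column₀-firstEntry Tab nonempty))

greedyTableau-columnConditions : ∀ S → SSYTRows S → ColumnConditions (greedyTableau S)
greedyTableau-columnConditions [] _ = record
  { nonempty = [] ; firstColumn = [] ; rowSteps = λ _ → [] ; tripleRule = λ _ → [] }
greedyTableau-columnConditions (S₀ ∷ Ss) rows = record
  { nonempty = column₀⇒NonEmptyRows Tab S₀ column₀
  ; firstColumn = column₀⇒FirstLe Tab S₀ column₀ (All.head (SSYTRows.sorted rows))
  ; rowSteps = λ k → subst (All RowStep) (sym (adjacentCells-zip k Tab)) (proj₁ (adjacentColumns k))
  ; tripleRule = λ k → subst (AllPairs TripleRule) (sym (adjacentCells-zip k Tab)) (proj₂ (adjacentColumns k))
  }
  where
  open GreedyTableau S₀ Ss rows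
  Tab = greedyTableau (S₀ ∷ Ss)

IsSSYRT⇒ColumnConditions : ∀ α v Tab → IsComposition α → IsSSYRT α v Tab → ColumnConditions Tab
IsSSYRT⇒ColumnConditions .(map length Tab) v Tab c (refl , _ , _ , strict , firstLe , condition₃) = record
  { nonempty = All.map⁻ c
  ; firstColumn = firstLe
  ; rowSteps = strictRows⇒RowStep strict
  ; tripleRule = Condition₃⇒TripleRule Tab condition₃
  }

≡-irrelevant-List : {xs ys : List ℕ} → Irrelevant (xs ≡ ys)
≡-irrelevant-List = UIP.Decidable⇒UIP.≡-irrelevant (≡-dec _≟_)

×-irrelevant : ∀ {A B : Set} → Irrelevant A → Irrelevant B → Irrelevant (A × B)
×-irrelevant irrA irrB (a , b) (a′ , b′) = cong₂ _,_ (irrA a a′) (irrB b b′)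

ColStrict-irrelevant : ∀ {r r′} → Irrelevant (ColStrict r r′)
ColStrict-irrelevant {_} {[]} tt tt = refl
ColStrict-irrelevant {a ∷ r} {b ∷ r′} (p , ps) (q , qs) = cong₂ _,_ (≤-irrelevant p q) (ColStrict-irrelevant ps qs)

FirstLe-irrelevant : ∀ {r r′} → Irrelevant (FirstLe r r′)
FirstLe-irrelevant {[]} tt tt = refl
FirstLe-irrelevant {_ ∷ _} {[]} tt tt = refl
FirstLe-irrelevant {_ ∷ _} {_ ∷ _} = ≤-irrelevant

PositiveEntries-irrelevant : ∀ {Tab} → Irrelevant (PositiveEntries Tab)
PositiveEntries-irrelevant = All.irrelevant (All.irrelevant ≤-irrelevant)

HasWeight-irrelevant : ∀ {v Tab} → Irrelevant (HasWeight v Tab)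
HasWeight-irrelevant = ×-irrelevant (All.irrelevant (All.irrelevant ≤-irrelevant)) ≡-irrelevant-List

IsSSYT-irrelevant : ∀ {λ′ v Tab} → Irrelevant (IsSSYT λ′ v Tab)
IsSSYT-irrelevant = ×-irrelevant ≡-irrelevant-List (×-irrelevant PositiveEntries-irrelevant
  (×-irrelevant HasWeight-irrelevant (×-irrelevant (All.irrelevant (Linked.irrelevant ≤-irrelevant))
    (Linked.irrelevant ColStrict-irrelevant))))

IsSSYRT-irrelevant : ∀ {α v Tab} → Irrelevant (IsSSYRT α v Tab)
IsSSYRT-irrelevant = ×-irrelevant ≡-irrelevant-List (×-irrelevant PositiveEntries-irrelevant
  (×-irrelevant HasWeight-irrelevant (×-irrelevant (All.irrelevant (Linked.irrelevant <-irrelevant))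
    (×-irrelevant (Linked.irrelevant FirstLe-irrelevant) (All.irrelevant T-irrelevant)))))

CompositionTableaux : List ℕ → List ℕ → Set
CompositionTableaux λ′ v = Σ (List ℕ) (λ α → IsComposition α × shape α ≡ conj λ′ × SSYRT α v)

CompositionTableaux-≡ : ∀ {λ′ v} {x y : CompositionTableaux λ′ v} →
  proj₁ (proj₂ (proj₂ (proj₂ x))) ≡ proj₁ (proj₂ (proj₂ (proj₂ y))) → x ≡ y
CompositionTableaux-≡ {x = α , c , s , Tab , h} {α′ , c′ , s′ , .Tab , h′} refl with proj₁ h | proj₁ h′
... | refl | refl rewrite All.irrelevant ≤-irrelevant c c′ | ≡-irrelevant-List s s′ | IsSSYRT-irrelevant h h′ = refl

SSYT-≡ : ∀ {λ′ v} {x y : SSYT λ′ v} → proj₁ x ≡ proj₁ y → x ≡ y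
SSYT-≡ {x = S , h} {.S , h′} refl = cong (S ,_) (IsSSYT-irrelevant h h′)

conj-conj≡shape : ∀ α → IsComposition α → conj (conj α) ≡ shape α
conj-conj≡shape α c = trans (cong conj (conj-↭ (↭-sym (shape-↭ α)))) (conj-involutive (shape α) (shape-isPartition α c))

shape≡conj⇒conj≡ : ∀ α {λ′} → IsPartition λ′ → shape α ≡ conj λ′ → conj α ≡ λ′
shape≡conj⇒conj≡ α {λ′} p e = trans (conj-↭ (↭-sym (shape-↭ α))) (trans (cong conj e) (conj-involutive λ′ p))

module _ (λ′ : List ℕ) (partition : IsPartition λ′) (v : List ℕ) where

  IsSSYT⇒SSYTRows : ∀ {S} → IsSSYT λ′ v S → SSYTRows S
  IsSSYT⇒SSYTRows (_ , _ , _ , sorted , colStrict) = record { sorted = sorted ; colStrict = colStrict }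

  IsSSYT⇒NonEmptyRows : ∀ {S} → IsSSYT λ′ v S → NonEmptyRows S
  IsSSYT⇒NonEmptyRows (refl , _) = All.map⁻ (proj₁ partition)

  ssyt→ssyrt : SSYT λ′ v → CompositionTableaux λ′ v
  ssyt→ssyrt (S , h@(shapeS , positiveS , weightS , _)) =
    map length Tab , All.map⁺ nonempty , shape≡ , Tab , refl ,
    PositiveEntries-↭ S Tab perm positiveS , HasWeight-↭ v S Tab perm weightS ,
    RowStep⇒strictRows Tab rowSteps , firstColumn , TripleRule⇒Condition₃ Tab tripleRule
    where
    Tab = greedyTableau S
    open ColumnConditions (greedyTableau-columnConditions S (IsSSYT⇒SSYTRows h))
    roundTrip : sortColumns Tab ≡ S
    roundTrip = sortColumns-greedyTableau S (IsSSYT⇒SSYTRows h) (IsSSYT⇒NonEmptyRows h)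
    perm : concat S ↭ concat Tab
    perm = subst (λ T → concat T ↭ concat Tab) roundTrip (concat-sortColumns Tab)
    shape≡ : shape (map length Tab) ≡ conj λ′
    shape≡ = begin
      shape (map length Tab)                 ≡⟨ sym (conj-conj≡shape _ (All.map⁺ nonempty)) ⟩
      conj (conj (map length Tab))           ≡⟨ cong conj (sym (shape-sortColumns Tab)) ⟩
      conj (map length (sortColumns Tab))    ≡⟨ cong (conj ∘ map length) roundTrip ⟩
      conj (map length S)                    ≡⟨ cong conj shapeS ⟩
      conj λ′                                ∎
      where open ≡-Reasoning

  ssyrt→ssyt : CompositionTableaux λ′ v → SSYT λ′ v
  ssyrt→ssyt (α , c , shapeα , Tab , h@(shapeT , positiveT , weightT , _)) =
    sortColumns Tab , shape≡ , PositiveEntries-↭ Tab _ perm positiveT , HasWeight-↭ v Tab _ perm weightT ,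
    SSYTRows.sorted ssytRows , SSYTRows.colStrict ssytRows
    where
    open SortColumns Tab (IsSSYRT⇒ColumnConditions α v Tab c h)
    perm : concat Tab ↭ concat (sortColumns Tab)
    perm = ↭-sym (concat-sortColumns Tab)
    shape≡ : map length (sortColumns Tab) ≡ λ′
    shape≡ = trans (shape-sortColumns Tab) (trans (cong conj shapeT) (shape≡conj⇒conj≡ α partition shapeα))

  ssyt→ssyrt→ssyt : ∀ x → ssyrt→ssyt (ssyt→ssyrt x) ≡ x
  ssyt→ssyrt→ssyt (S , h) = SSYT-≡ (sortColumns-greedyTableau S (IsSSYT⇒SSYTRows h) (IsSSYT⇒NonEmptyRows h))

  ssyrt→ssyt→ssyrt : ∀ y → ssyt→ssyrt (ssyrt→ssyt y) ≡ y
  ssyrt→ssyt→ssyrt (α , c , _ , Tab , h) =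
    CompositionTableaux-≡ {λ′} {v} (greedyTableau-sortColumns Tab (IsSSYRT⇒ColumnConditions α v Tab c h))

theorem1 : (λ′ : List ℕ) → IsPartition λ′ → (v : List ℕ) →
    SSYT λ′ v ↔ Σ (List ℕ) (λ α → IsComposition α × shape α ≡ conj λ′ × SSYRT α v)
theorem1 λ′ partition v =
  mk↔ₛ′ (ssyt→ssyrt λ′ partition v) (ssyrt→ssyt λ′ partition v)
    (ssyrt→ssyt→ssyrt λ′ partition v) (ssyt→ssyrt→ssyt λ′ partition v)
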